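{- Let $M$ be a $\lambda\mu$-term, $t\in\mathcal T(M)$ and $\mathcal T'$ a sum such that $t\to_{\mathrm{base}^r}\mathcal T'$. Then there is a $\lambda\mu$-term $N$ with $M\to N$ and $\mathcal T'\subseteq\mathcal T(N)$.
   Context: Fix disjoint countably infinite sets of variables and names. $\lambda\mu$-terms: $M::=x\mid\lambda x.M\mid MM\mid\mu\alpha.{}_\beta|M|$, up to renaming of bound variables and names. Named application $(M)_\alpha N$: - $(x)_\alpha N=x$, $(\lambda x.M)_\alpha N=\lambda x.(M)_\alpha N$, $(MP)_\alpha N=((M)_\alpha N)((P)_\alpha N)$. - $(\mu\beta.{}_\gamma|M|)_\alpha N=\mu\beta.{}_\gamma|(M)_\alpha N|$ ($\gamma\ne\alpha$), and $(\mu\beta.{}_\alpha|M|)_\alpha N=\mu\beta.{}_\alpha|((M)_\alpha N)N|$. - On named terms: $({}_\gamma|M|)_\alpha N={}_\gamma|(M)_\alpha N|$ ($\gamma\neq\alpha$), and $({}_\alpha|M|)_\alpha N={}_\alpha|((M)_\alpha N)N|$. Reduction on $\lambda\mu$-terms. $\to$ is the closure under single-hole contexts of $(\lambda x.M)N\to M\{N/x\}$, $(\mu\alpha.{}_\beta|M|)N\to\mu\alpha.({}_\beta|M|)_\alpha N$, and $\mu\gamma.{}_\alpha|\mu\beta.{}_\eta|M||\to\mu\gamma.({}_\eta|M|)\{\alpha/\beta\}$. Resource terms and sums. - Resource terms: $t::=x\mid\lambda x.t\mid t[t_1,\dots,t_n]\mid\mu\alpha.{}_\beta|t|$, with bags finite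 multisets; $1$ is the empty bag. - Sums are finite sets with idempotent $+$ and empty sum $0$; constructors extend multilinearly, and $0$ annihilates. - A weak composition (w.c.) of a bag $B$ is a tuple of possibly empty bags whose union is $B$. Linear substitution $t\langle B/x\rangle$: - $x\langle[v]/x\rangle=v$, and $x\langle B/x\rangle=0$ otherwise. - For $y\ne x$: $y\langle1/x\rangle=y$, and $y\langle B/x\rangle=0$ if $B\ne1$. - It commutes with $\lambda y$ and with $\mu\alpha.{}_\beta|\cdot|$. - $(t[v_1..v_n])\langle B/x\rangle=\sum_{(B_0..B_n)\text{ w.c.}}t\langle B_0/x\rangle[v_i\langle B_i/x\rangle]_i$. Linear named application $\langle t\rangle_\alpha B$: - $\langle x\rangle_\alpha1=x$, and $\langle x\rangle_\alpha B=0$ if $B\ne1$. - It commutes with $\lambda y$ and with $\mu\gamma$. - $\langle{}_\eta|t|\rangle_\alpha B={}_\eta|\langle t\rangle_\alpha B|$ ($\eta\ne\alpha$), and $\langle{}_\alpha|t|\rangle_\alpha B=\sum_{(B_1,B_2)\text{ w.c.}}{}_\alpha|(\langle t\rangle_\alpha B_1)B_2|$. - $\langle t[v_1..v_n]\rangle_\alpha B=\sum_{(B_0..B_n)}(\langle t\rangle_\alpha B_0)[\langle v_i\rangle_\alpha B_i]_i$. Root resource reduction. $\to_{\mathrm{base}^r}$ is the union (applied at the root only, not under contexts) of $(\lambda x.t)B\to t\langle B/x\rangle$, $(\mu\alpha.{}_\beta|t|)B\to\mu\alpha.\langle{}_\beta|t|\rangle_\alpha B$, and $\mu\gamma.{}_\alpha|\mu\beta.{}_\eta|t||\to\mu\gamma.({}_\eta|t|)\{\alpha/\beta\}$.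 Taylor expansion. - $\mathcal T(x)=\{x\}$, $\mathcal T(\lambda x.M)=\{\lambda x.t\mid t\in\mathcal T(M)\}$, $\mathcal T(\mu\alpha.{}_\beta|M|)=\{\mu\alpha.{}_\beta|t|\mid t\in\mathcal T(M)\}$. - $\mathcal T(MN)=\{t[u_1..u_n]\mid t\in\mathcal T(M),n\ge0,u_i\in\mathcal T(N)\}$. -}

module Defs where

-- Variables and names are de Bruijn indices, well-scoped: a term of type
-- Term n m / RTerm n m has at most n free variables and m free names.
-- This realises "up to renaming of bound variables and names".

open import Data.Nat using (ℕ; zero; suc)
open import Data.Fin using (Fin; zero; suc; punchOut; _≟_)
open import Data.List using (List; []; _∷_; map; concatMap; length)
open import Data.List.Membership.Propositional using (_∈_)
open import Data.List.Relation.Unary.All using (All)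
open import Data.Product using (_×_; _,_)
open import Relation.Nullary using (yes; no)

-- λμ-terms.  mu β M  stands for  μα.β|M|  (α = the bound name, index 0,
-- β : Fin (suc m) is a name in the scope extended by α).

data Term (n m : ℕ) : Set where
  var : Fin n → Term n m
  lam : Term (suc n) m → Term n m
  app : Term n m → Term n m → Term n m
  mu  : Fin (suc m) → Term n (suc m) → Term n m

liftR : ∀ {k k'} → (Fin k → Fin k') → Fin (suc k) → Fin (suc k')
liftR ρ zero    = zero
liftR ρ (suc i) = suc (ρ i)

renV : ∀ {n n' m} → (Fin n → Fin n') → Term n m → Term n' m
renV ρ (var x)   = var (ρ x)
renV ρ (lam M)   = lam (renV (liftR ρ) M)
renV ρ (app M N) = app (renV ρ M) (renV ρ N)
renV ρ (mu β M)  = mu β (renV ρ M)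

renN : ∀ {n m m'} → (Fin m → Fin m') → Term n m → Term n m'
renN ρ (var x)   = var x
renN ρ (lam M)   = lam (renN ρ M)
renN ρ (app M N) = app (renN ρ M) (renN ρ N)
renN ρ (mu β M)  = mu (liftR ρ β) (renN (liftR ρ) M)

liftS : ∀ {n n' m} → (Fin n → Term n' m) → Fin (suc n) → Term (suc n') m
liftS σ zero    = var zero
liftS σ (suc i) = renV suc (σ i)

sub : ∀ {n n' m} → (Fin n → Term n' m) → Term n m → Term n' m
sub σ (var x)   = σ x
sub σ (lam M)   = lam (sub (liftS σ) M)
sub σ (app M N) = app (sub σ M) (sub σ N)
sub σ (mu β M)  = mu β (sub (λ i → renN suc (σ i)) M)

sub0 : ∀ {n m} → Term n m → Fin (suc n) → Term n m
sub0 N zero    = N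
sub0 N (suc i) = var i

_[_/0] : ∀ {n m} → Term (suc n) m → Term n m → Term n m
M [ N /0] = sub (sub0 N) M

nameSub : ∀ {m} → Fin (suc m) → Fin (suc (suc m)) → Fin (suc m)
nameSub α zero    = α
nameSub α (suc i) = i

-- Named application (M)_α N.  namedMu γ M α N  is  (μβ.γ|M|)_{α} N
-- where α, γ, M, N live in the scope extended by the bound name β.
mutual
  napp : ∀ {n m} → Term n m → Fin m → Term n m → Term n m
  napp (var x)   α N = var x
  napp (lam M)   α N = lam (napp M α (renV suc N))
  napp (app M P) α N = app (napp M α N) (napp P α N)
  napp (mu γ M)  α N = namedMu γ M (suc α) (renN suc N)

  namedMu : ∀ {n m} → Fin (suc m) → Term n (suc m) → Fin (suc m)
          → Term n (suc m) → Term n m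
  namedMu γ M α N with γ ≟ α
  ... | yes _ = mu γ (app (napp M α N) N)
  ... | no  _ = mu γ (napp M α N)

data _↦root_ {n m : ℕ} : Term n m → Term n m → Set where
  rβ  : ∀ {M N} → app (lam M) N ↦root (M [ N /0])
  rμ  : ∀ {β M N} → app (mu β M) N ↦root namedMu β M zero (renN suc N)
  rμμ : ∀ {α η M} → mu α (mu η M) ↦root mu (nameSub α η) (renN (nameSub α) M)

data _⟶_ : {n m : ℕ} → Term n m → Term n m → Set where
  root : ∀ {n m} {M N : Term n m} → M ↦root N → M ⟶ N
  ξlam : ∀ {n m} {M N : Term (suc n) m} → M ⟶ N → lam M ⟶ lam N
  ξappL : ∀ {n m} {M M' N : Term n m} → M ⟶ M' → app M N ⟶ app M' N
  ξappR : ∀ {n m} {M N N' : Term n m} → N ⟶ N' → app M N ⟶ app M N'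
  ξmu  : ∀ {n m} {β} {M N : Term n (suc m)} → M ⟶ N → mu β M ⟶ mu β N

-- Bags are finite multisets, represented by lists
-- (order is immaterial for everything below).  Sums are finite sets of
-- resource terms, represented by lists, compared by membership.

data RTerm (n m : ℕ) : Set where
  var : Fin n → RTerm n m
  lam : RTerm (suc n) m → RTerm n m
  app : RTerm n m → List (RTerm n m) → RTerm n m
  mu  : Fin (suc m) → RTerm n (suc m) → RTerm n m

Bag : ℕ → ℕ → Set
Bag n m = List (RTerm n m)

Sum : ℕ → ℕ → Set
Sum n m = List (RTerm n m)

mutual
  rrenV : ∀ {n n' m} → (Fin n → Fin n') → RTerm n m → RTerm n' m
  rrenV ρ (var x)    = var (ρ x)
  rrenV ρ (lam t)    = lam (rrenV (liftR ρ) t)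
  rrenV ρ (app t vs) = app (rrenV ρ t) (rrenVBag ρ vs)
  rrenV ρ (mu β t)   = mu β (rrenV ρ t)

  rrenVBag : ∀ {n n' m} → (Fin n → Fin n') → Bag n m → Bag n' m
  rrenVBag ρ []       = []
  rrenVBag ρ (v ∷ vs) = rrenV ρ v ∷ rrenVBag ρ vs

mutual
  rrenN : ∀ {n m m'} → (Fin m → Fin m') → RTerm n m → RTerm n m'
  rrenN ρ (var x)    = var x
  rrenN ρ (lam t)    = lam (rrenN ρ t)
  rrenN ρ (app t vs) = app (rrenN ρ t) (rrenNBag ρ vs)
  rrenN ρ (mu β t)   = mu (liftR ρ β) (rrenN (liftR ρ) t)

  rrenNBag : ∀ {n m m'} → (Fin m → Fin m') → Bag n m → Bag n m'
  rrenNBag ρ []       = []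
  rrenNBag ρ (v ∷ vs) = rrenN ρ v ∷ rrenNBag ρ vs

split2 : ∀ {A : Set} → List A → List (List A × List A)
split2 []       = ([] , []) ∷ []
split2 (a ∷ as) = concatMap (λ { (L , R) → (a ∷ L , R) ∷ (L , a ∷ R) ∷ [] }) (split2 as)

wc : ∀ {A : Set} → ℕ → List A → List (List (List A))
wc zero    []      = [] ∷ []
wc zero    (_ ∷ _) = []
wc (suc k) B       = concatMap (λ { (B₀ , R) → map (B₀ ∷_) (wc k R) }) (split2 B)

ifSingleton : ∀ {n m} → Bag n m → Sum n m
ifSingleton (v ∷ []) = v ∷ []
ifSingleton _        = []

ifEmpty : ∀ {n m} → RTerm n m → Bag n m → Sum n m
ifEmpty u []      = u ∷ []
ifEmpty u (_ ∷ _) = []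

mutual
  lsub : ∀ {n m} → RTerm (suc n) m → Fin (suc n) → Bag n m → Sum n m
  lsub (var i) x B with x ≟ i
  ... | yes _  = ifSingleton B
  ... | no x≢i = ifEmpty (var (punchOut x≢i)) B
  lsub (lam t)    x B = map lam (lsub t (suc x) (rrenVBag suc B))
  lsub (mu β t)   x B = map (mu β) (lsub t x (rrenNBag suc B))
  lsub (app t vs) x B =
    concatMap (λ { [] → []
                 ; (B₀ ∷ Bs) → concatMap (λ t' → map (app t') (lsubBag vs x Bs))
                                         (lsub t x B₀) })
              (wc (suc (length vs)) B)

  lsubBag : ∀ {n m} → Bag (suc n) m → Fin (suc n) → List (Bag n m) → List (Bag n m)
  lsubBag []       x []       = [] ∷ []
  lsubBag (v ∷ vs) x (B ∷ Bs) =
    concatMap (λ v' → map (v' ∷_) (lsubBag vs x Bs)) (lsub v x B)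
  lsubBag _        x _        = []

-- Linear named application ⟨t⟩_α B.
-- lnmu η t α B  is  μγ.⟨η|t|⟩_α B  with α, η, t, B in the scope extended by γ.
mutual
  lnapp : ∀ {n m} → RTerm n m → Fin m → Bag n m → Sum n m
  lnapp (var x)    α B = ifEmpty (var x) B
  lnapp (lam t)    α B = map lam (lnapp t α (rrenVBag suc B))
  lnapp (mu η t)   α B = lnmu η t (suc α) (rrenNBag suc B)
  lnapp (app t vs) α B =
    concatMap (λ { [] → []
                 ; (B₀ ∷ Bs) → concatMap (λ t' → map (app t') (lnappBag vs α Bs))
                                         (lnapp t α B₀) })
              (wc (suc (length vs)) B)

  lnappBag : ∀ {n m} → Bag n m → Fin m → List (Bag n m) → List (Bag n m)
  lnappBag []       α []       = [] ∷ []
  lnappBag (v ∷ vs) α (B ∷ Bs) =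
    concatMap (λ v' → map (v' ∷_) (lnappBag vs α Bs)) (lnapp v α B)
  lnappBag _        α _        = []

  lnmu : ∀ {n m} → Fin (suc m) → RTerm n (suc m) → Fin (suc m)
       → Bag n (suc m) → Sum n m
  lnmu η t α B with η ≟ α
  ... | yes _ = concatMap (λ { (B₁ ∷ B₂ ∷ []) → map (λ t' → mu η (app t' B₂)) (lnapp t α B₁)
                             ; _ → [] })
                          (wc 2 B)
  ... | no _  = map (mu η) (lnapp t α B)

data _→baseʳ_ {n m : ℕ} : RTerm n m → Sum n m → Set where
  bβ  : ∀ {t B} → app (lam t) B →baseʳ lsub t zero B
  bμ  : ∀ {β t B} → app (mu β t) B →baseʳ lnmu β t zero (rrenNBag suc B)
  bμμ : ∀ {α η t} → mu α (mu η t) →baseʳ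
          (mu (nameSub α η) (rrenN (nameSub α) t) ∷ [])

-- Taylor expansion, as a membership predicate  t ∈𝒯 M.

data _∈𝒯_ : {n m : ℕ} → RTerm n m → Term n m → Set where
  tvar : ∀ {n m} {x : Fin n} → _∈𝒯_ {n} {m} (var x) (var x)
  tlam : ∀ {n m} {t : RTerm (suc n) m} {M} → t ∈𝒯 M → lam t ∈𝒯 lam M
  tmu  : ∀ {n m} {β : Fin (suc m)} {t : RTerm n (suc m)} {M}
       → t ∈𝒯 M → mu β t ∈𝒯 mu β M
  tapp : ∀ {n m} {t : RTerm n m} {us M N}
       → t ∈𝒯 M → All (_∈𝒯 N) us → app t us ∈𝒯 app M N

_⊆𝒯_ : ∀ {n m} → Sum n m → Term n m → Set
T' ⊆𝒯 N = ∀ u → u ∈ T' → u ∈𝒯 N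

module Submission where

-- Each resource operation maps elements of the Taylor expansions of its arguments into the
-- Taylor expansion of the corresponding λμ-operation: linear substitution t⟨B/x⟩ lands in
-- 𝒯(M{N/x}), linear named application ⟨t⟩_α B in 𝒯((M)_α N), and renaming of names commutes
-- with 𝒯.  A root resource step out of t ∈ 𝒯(M) is therefore simulated by the root step of
-- the same kind out of M.

open import Defs
open import Data.Nat using (ℕ; zero; suc)
open import Data.Product using (Σ; _×_; _,_; ∃; ∃₂)
open import Data.Fin using (Fin; zero; suc; punchOut; _≟_)
open import Data.List using (List; []; _∷_; map; concatMap; length)
open import Data.List.Membership.Propositional using (_∈_; find)
open import Data.List.Membership.Propositional.Properties using (∈-map⁻; ∈-concatMap⁻)
open import Data.List.Relation.Unary.All using (All; []; _∷_; lookup)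
open import Data.List.Relation.Unary.Any using (here; there)
open import Relation.Binary.PropositionalEquality using (_≡_; _≢_; refl; cong; sym; subst)
open import Relation.Nullary using (yes; no)
open import Data.Empty using (⊥-elim)
open import Function using (_∘_)

∈-concatMap-find : ∀ {A B : Set} {f : A → List B} {y : B} (xs : List A)
                 → y ∈ concatMap f xs → ∃ λ x → x ∈ xs × y ∈ f x
∈-concatMap-find {f = f} xs = find ∘ ∈-concatMap⁻ f {xs = xs}

∈-concatMap-map⁻ : ∀ {A B C : Set} (g : A → B → C) (as : List A) (bs : List B) {c : C}
                 → c ∈ concatMap (λ a → map (g a) bs) as
                 → ∃₂ λ a b → a ∈ as × b ∈ bs × c ≡ g a b
∈-concatMap-map⁻ g as bs c∈ with ∈-concatMap-find as c∈
... | a , a∈ , c∈ga with ∈-map⁻ (g a) c∈ga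
... | b , b∈ , refl = a , b , a∈ , b∈ , refl

split2-All : ∀ {A : Set} {P : A → Set} (B : List A) {L R : List A}
           → (L , R) ∈ split2 B → All P B → All P L × All P R
split2-All [] (here refl) [] = [] , []
split2-All (a ∷ as) LR∈ (pa ∷ pas) with ∈-concatMap-find (split2 as) LR∈
... | _ , LR'∈ , here refl with split2-All as LR'∈ pas
...   | pL , pR = pa ∷ pL , pR
split2-All (a ∷ as) LR∈ (pa ∷ pas) | _ , LR'∈ , there (here refl) with split2-All as LR'∈ pas
...   | pL , pR = pL , pa ∷ pR

wc-All : ∀ {A : Set} {P : A → Set} (k : ℕ) (B : List A) {Bs : List (List A)}
       → Bs ∈ wc k B → All P B → All (All P) Bs
wc-All zero    []  (here refl) [] = []
wc-All (suc k) B Bs∈ pB with ∈-concatMap-find (split2 B) Bs∈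
... | (B₀ , R) , split∈ , Bs∈′ with ∈-map⁻ (B₀ ∷_) Bs∈′
... | Bs , Bs∈wc , refl with split2-All B split∈ pB
... | pB₀ , pR = pB₀ ∷ wc-All k R Bs∈wc pR

∈-ifSingleton⁻ : ∀ {n m} (B : Bag n m) {u : RTerm n m} → u ∈ ifSingleton B → u ∈ B
∈-ifSingleton⁻ (v ∷ []) u∈ = u∈

∈-ifEmpty⁻ : ∀ {n m} {v : RTerm n m} (B : Bag n m) {u : RTerm n m} → u ∈ ifEmpty v B → u ≡ v
∈-ifEmpty⁻ [] (here u≡v) = u≡v

mutual
  ∈𝒯-renV : ∀ {n n' m} (ρ : Fin n → Fin n') {t : RTerm n m} {M : Term n m}
          → t ∈𝒯 M → rrenV ρ t ∈𝒯 renV ρ M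
  ∈𝒯-renV ρ tvar          = tvar
  ∈𝒯-renV ρ (tlam t∈)     = tlam (∈𝒯-renV (liftR ρ) t∈)
  ∈𝒯-renV ρ (tmu t∈)      = tmu (∈𝒯-renV ρ t∈)
  ∈𝒯-renV ρ (tapp t∈ us∈) = tapp (∈𝒯-renV ρ t∈) (∈𝒯-renVBag ρ us∈)

  ∈𝒯-renVBag : ∀ {n n' m} (ρ : Fin n → Fin n') {us : Bag n m} {N : Term n m}
              → All (_∈𝒯 N) us → All (_∈𝒯 renV ρ N) (rrenVBag ρ us)
  ∈𝒯-renVBag ρ []          = []
  ∈𝒯-renVBag ρ (u∈ ∷ us∈) = ∈𝒯-renV ρ u∈ ∷ ∈𝒯-renVBag ρ us∈

mutual
  ∈𝒯-renN : ∀ {n m m'} (ρ : Fin m → Fin m') {t : RTerm n m} {M : Term n m}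
          → t ∈𝒯 M → rrenN ρ t ∈𝒯 renN ρ M
  ∈𝒯-renN ρ tvar          = tvar
  ∈𝒯-renN ρ (tlam t∈)     = tlam (∈𝒯-renN ρ t∈)
  ∈𝒯-renN ρ (tmu t∈)      = tmu (∈𝒯-renN (liftR ρ) t∈)
  ∈𝒯-renN ρ (tapp t∈ us∈) = tapp (∈𝒯-renN ρ t∈) (∈𝒯-renNBag ρ us∈)

  ∈𝒯-renNBag : ∀ {n m m'} (ρ : Fin m → Fin m') {us : Bag n m} {N : Term n m}
              → All (_∈𝒯 N) us → All (_∈𝒯 renN ρ N) (rrenNBag ρ us)
  ∈𝒯-renNBag ρ []          = []
  ∈𝒯-renNBag ρ (u∈ ∷ us∈) = ∈𝒯-renN ρ u∈ ∷ ∈𝒯-renNBag ρ us∈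

-- The λμ-substitution σ must treat the variables other than x as lsub does: by punching x out.
PunchesOut : ∀ {n m} → (Fin (suc n) → Term n m) → Fin (suc n) → Set
PunchesOut σ x = ∀ i (x≢i : x ≢ i) → var (punchOut x≢i) ∈𝒯 σ i

PunchesOut-liftS : ∀ {n m} {σ : Fin (suc n) → Term n m} {x : Fin (suc n)}
                 → PunchesOut σ x → PunchesOut (liftS σ) (suc x)
PunchesOut-liftS σx zero    _    = tvar
PunchesOut-liftS σx (suc i) x≢i = ∈𝒯-renV suc (σx i (x≢i ∘ cong suc))

PunchesOut-renN : ∀ {n m} {σ : Fin (suc n) → Term n m} {x : Fin (suc n)}
                → PunchesOut σ x → PunchesOut (λ i → renN suc (σ i)) x
PunchesOut-renN σx i x≢i = ∈𝒯-renN suc (σx i x≢i)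

PunchesOut-sub0 : ∀ {n m} (N : Term n m) → PunchesOut (sub0 N) zero
PunchesOut-sub0 N zero    0≢0 = ⊥-elim (0≢0 refl)
PunchesOut-sub0 N (suc i) _   = tvar

mutual
  lsub-⊆𝒯 : ∀ {n m} (σ : Fin (suc n) → Term n m) (x : Fin (suc n))
            {t : RTerm (suc n) m} {M : Term (suc n) m} {B : Bag n m}
          → t ∈𝒯 M → All (_∈𝒯 σ x) B → PunchesOut σ x → lsub t x B ⊆𝒯 sub σ M
  lsub-⊆𝒯 σ x {B = B} (tvar {x = i}) B∈ σx u u∈ with x ≟ i
  ... | yes refl = lookup B∈ (∈-ifSingleton⁻ B u∈)
  ... | no x≢i  = subst (_∈𝒯 σ i) (sym (∈-ifEmpty⁻ B u∈)) (σx i x≢i)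
  lsub-⊆𝒯 σ x (tlam t∈) B∈ σx u u∈ with ∈-map⁻ lam u∈
  ... | t' , t'∈ , refl =
    tlam (lsub-⊆𝒯 (liftS σ) (suc x) t∈ (∈𝒯-renVBag suc B∈) (PunchesOut-liftS σx) t' t'∈)
  lsub-⊆𝒯 σ x (tmu t∈) B∈ σx u u∈ with ∈-map⁻ (mu _) u∈
  ... | t' , t'∈ , refl =
    tmu (lsub-⊆𝒯 (λ i → renN suc (σ i)) x t∈ (∈𝒯-renNBag suc B∈) (PunchesOut-renN σx) t' t'∈)
  lsub-⊆𝒯 σ x {B = B} (tapp {t = t} {us = vs} t∈ vs∈) B∈ σx u u∈
    with ∈-concatMap-find (wc (suc (length vs)) B) u∈
  ... | [] , _ , ()
  ... | B₀ ∷ Bs , Bs∈wc , u∈′ with wc-All (suc (length vs)) B Bs∈wc B∈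
  ... | B₀∈ ∷ Bs∈ with ∈-concatMap-map⁻ app (lsub t x B₀) (lsubBag vs x Bs) u∈′
  ... | t' , bag , t'∈ , bag∈ , refl =
    tapp (lsub-⊆𝒯 σ x t∈ B₀∈ σx t' t'∈) (lsubBag-⊆𝒯 σ x vs∈ Bs∈ σx bag∈)

  lsubBag-⊆𝒯 : ∀ {n m} (σ : Fin (suc n) → Term n m) (x : Fin (suc n))
               {vs : Bag (suc n) m} {N : Term (suc n) m} {Bs : List (Bag n m)}
             → All (_∈𝒯 N) vs → All (All (_∈𝒯 σ x)) Bs → PunchesOut σ x
             → ∀ {bag} → bag ∈ lsubBag vs x Bs → All (_∈𝒯 sub σ N) bag
  lsubBag-⊆𝒯 σ x [] [] σx (here refl) = []
  lsubBag-⊆𝒯 σ x {vs = v ∷ vs} {Bs = B ∷ Bs} (v∈ ∷ vs∈) (B∈ ∷ Bs∈) σx bag∈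
    with ∈-concatMap-map⁻ _∷_ (lsub v x B) (lsubBag vs x Bs) bag∈
  ... | v' , bag , v'∈ , bag∈′ , refl =
    lsub-⊆𝒯 σ x v∈ B∈ σx v' v'∈ ∷ lsubBag-⊆𝒯 σ x vs∈ Bs∈ σx bag∈′

mutual
  lnapp-⊆𝒯 : ∀ {n m} (α : Fin m) {t : RTerm n m} {M N : Term n m} {B : Bag n m}
           → t ∈𝒯 M → All (_∈𝒯 N) B → lnapp t α B ⊆𝒯 napp M α N
  lnapp-⊆𝒯 α {B = B} tvar B∈ u u∈ = subst (_∈𝒯 _) (sym (∈-ifEmpty⁻ B u∈)) tvar
  lnapp-⊆𝒯 α (tlam t∈) B∈ u u∈ with ∈-map⁻ lam u∈
  ... | t' , t'∈ , refl = tlam (lnapp-⊆𝒯 α t∈ (∈𝒯-renVBag suc B∈) t' t'∈)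
  lnapp-⊆𝒯 α (tmu {β = η} t∈) B∈ = lnmu-⊆𝒯 η (suc α) t∈ (∈𝒯-renNBag suc B∈)
  lnapp-⊆𝒯 α {B = B} (tapp {t = t} {us = vs} t∈ vs∈) B∈ u u∈
    with ∈-concatMap-find (wc (suc (length vs)) B) u∈
  ... | [] , _ , ()
  ... | B₀ ∷ Bs , Bs∈wc , u∈′ with wc-All (suc (length vs)) B Bs∈wc B∈
  ... | B₀∈ ∷ Bs∈ with ∈-concatMap-map⁻ app (lnapp t α B₀) (lnappBag vs α Bs) u∈′
  ... | t' , bag , t'∈ , bag∈ , refl =
    tapp (lnapp-⊆𝒯 α t∈ B₀∈ t' t'∈) (lnappBag-⊆𝒯 α vs∈ Bs∈ bag∈)

  lnappBag-⊆𝒯 : ∀ {n m} (α : Fin m) {vs : Bag n m} {M N : Term n m} {Bs : List (Bag n m)}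
              → All (_∈𝒯 M) vs → All (All (_∈𝒯 N)) Bs
              → ∀ {bag} → bag ∈ lnappBag vs α Bs → All (_∈𝒯 napp M α N) bag
  lnappBag-⊆𝒯 α [] [] (here refl) = []
  lnappBag-⊆𝒯 α {vs = v ∷ vs} {Bs = B ∷ Bs} (v∈ ∷ vs∈) (B∈ ∷ Bs∈) bag∈
    with ∈-concatMap-map⁻ _∷_ (lnapp v α B) (lnappBag vs α Bs) bag∈
  ... | v' , bag , v'∈ , bag∈′ , refl =
    lnapp-⊆𝒯 α v∈ B∈ v' v'∈ ∷ lnappBag-⊆𝒯 α vs∈ Bs∈ bag∈′

  lnmu-⊆𝒯 : ∀ {n m} (η α : Fin (suc m)) {t : RTerm n (suc m)} {M N : Term n (suc m)}
              {B : Bag n (suc m)}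
          → t ∈𝒯 M → All (_∈𝒯 N) B → lnmu η t α B ⊆𝒯 namedMu η M α N
  lnmu-⊆𝒯 η α {B = B} t∈ B∈ u u∈ with η ≟ α
  ... | no _ with ∈-map⁻ (mu η) u∈
  ...   | t' , t'∈ , refl = tmu (lnapp-⊆𝒯 α t∈ B∈ t' t'∈)
  lnmu-⊆𝒯 η α {B = B} t∈ B∈ u u∈ | yes _ with ∈-concatMap-find (wc 2 B) u∈
  ... | B₁ ∷ B₂ ∷ [] , Bs∈wc , u∈′ with wc-All 2 B Bs∈wc B∈
  ... | B₁∈ ∷ B₂∈ ∷ [] with ∈-map⁻ (λ t' → mu η (app t' B₂)) u∈′
  ... | t' , t'∈ , refl = tmu (tapp (lnapp-⊆𝒯 α t∈ B₁∈ t' t'∈) B₂∈)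

proposition3p7 : ∀ {n m : ℕ} (M : Term n m) (t : RTerm n m) (T' : Sum n m)
               → t ∈𝒯 M → t →baseʳ T'
               → Σ (Term n m) (λ N → (M ⟶ N) × (T' ⊆𝒯 N))
proposition3p7 (app (lam M) N) _ _ (tapp (tlam t∈) B∈) bβ =
  _ , root rβ , lsub-⊆𝒯 (sub0 N) zero t∈ B∈ (PunchesOut-sub0 N)
proposition3p7 (app (mu β M) N) _ _ (tapp (tmu t∈) B∈) bμ =
  _ , root rμ , lnmu-⊆𝒯 β zero t∈ (∈𝒯-renNBag suc B∈)
proposition3p7 (mu α (mu η M)) _ _ (tmu (tmu t∈)) bμμ =
  _ , root rμμ , λ { _ (here refl) → tmu (∈𝒯-renN (nameSub α) t∈) }
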